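{- Let $\mathfrak{D} = \langle \mathfrak{M}, \star\rangle$ be a class of dynamic models. The following axiom schema is valid in $\mathfrak{D}$ for any $\varphi \in \mathcal{L}_0$ and $\xi \in \mathcal{L}_\leq(\star)$ iff $\star$ is $\mathfrak{M}$-CR4-compliant: $$ {}[\star \varphi][\leq](\neg \varphi \rightarrow \xi) \rightarrow (\varphi \rightarrow [\leq] [\star \varphi] (\neg \varphi\rightarrow \xi))$$
   Context: Fix a set $P$ of propositional letters; $\mathcal{L}_0$ is the classical propositional language over $P$. A (well-founded) preference model is $M=\langle W,\leq,v\rangle$ with $W$ a set of worlds, $\leq$ a reflexive, transitive relation on $W$ whose strict part $<$ is well-founded, and $v:P\to 2^W$ a valuation; $\mathit{Mod}(\mathcal{L}_\leq)$ is the class of all such models. A dynamic operator is a map $\star:\mathit{Mod}(\mathcal{L}_\leq)\times\mathcal{L}_0\to\mathit{Mod}(\mathcal{L}_\leq)$ with $\star(M,\varphi)=\langle W,\leq_{\star\varphi},v\rangle$ (same worlds and valuation). The language $\mathcal{L}_\leq(\star)$ is built from $P$ with $\neg,\wedge$, the universal modality $A$, the modalities $[\leq]$, $[<]$, and formulas $[\star\varphi]\xi$ with $\varphi\in\mathcal{L}_0$. A dynamic model is $D=\langle M,\star\rangle$, with $D,w\vDash A\xi$ iff every world satisfies $\xi$, $D,w\vDash[\leq]\xi$ iff every $w'\leq w$ satisfies $\xi$, $D,w\vDash[<]\xi$ iff every $w'<w$ satisfies $\xi$, and $D,w\vDash[\star\varphi]\xi$ iff $\langle\star(M,\varphi),\star\rangle,w\vDash\xi$.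 For a class $\mathfrak{M}$ of preference models over which $\star$ is closed, $\mathfrak{D}=\langle\mathfrak{M},\star\rangle$ is the class of dynamic models $\langle M,\star\rangle$ with $M\in\mathfrak{M}$; a formula is valid in $\mathfrak{D}$ if it is true at every world of every such model. $[\![\varphi]\!]$ denotes the set of worlds of the model under consideration satisfying $\varphi$. $\star$ is $\mathfrak{M}$-CR4-compliant if for every $M=\langle W,\leq,v\rangle\in\mathfrak{M}$, every $\varphi\in\mathcal{L}_0$ and all $w,w'\in W$, with $D=\langle M,\star\rangle$: (CR4a) if $w\notin[\![\varphi]\!]$, $w'\in[\![\varphi]\!]$ and $w\leq w'$, then for every information $\xi$ with $D,w\vDash[\star\varphi]\xi$ there is $w''\notin[\![\varphi]\!]$ with $D,w''\vDash[\star\varphi]\xi$ and $w''\leq_{\star\varphi}w'$. -}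

module Defs where

open import Data.Product using (Σ; _×_; _,_)
open import Data.Sum using (_⊎_)
open import Relation.Nullary using (¬_)
open import Relation.Unary using (Pred)
open import Induction.WellFounded using (WellFounded)
open import Function.Bundles using (_⇔_)

data L₀ (P : Set) : Set where
  atom : P → L₀ P
  ¬₀_  : L₀ P → L₀ P
  _∧₀_ : L₀ P → L₀ P → L₀ P

record PrefOrder (W : Set) : Set₁ where
  field
    _≤_   : W → W → Set
    ≤-refl  : ∀ {w} → w ≤ w
    ≤-trans : ∀ {u w x} → u ≤ w → w ≤ x → u ≤ x
  _<_ : W → W → Set
  w < w' = (w ≤ w') × ¬ (w' ≤ w)
  field
    <-wf : WellFounded _<_

record PrefModel (P : Set) : Set₁ where
  field
    W     : Set
    order : PrefOrder W
    v     : P → Pred W _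
  open PrefOrder order public

open PrefModel

DynOp : Set → Set₁
DynOp P = (M : PrefModel P) → L₀ P → PrefOrder (W M)

upd : {P : Set} → DynOp P → PrefModel P → L₀ P → PrefModel P
upd ⋆ M φ = record { W = W M ; order = ⋆ M φ ; v = v M }

data L≤ (P : Set) : Set where
  atom   : P → L≤ P
  ∼_     : L≤ P → L≤ P
  _∧_    : L≤ P → L≤ P → L≤ P
  A      : L≤ P → L≤ P
  [≤]    : L≤ P → L≤ P
  [<]    : L≤ P → L≤ P
  [⋆_]_  : L₀ P → L≤ P → L≤ P

infix 30 ∼_
infixr 25 _∧_
infixr 20 _⇒_

ι : {P : Set} → L₀ P → L≤ P
ι (atom p) = atom p
ι (¬₀ φ) = ∼ ι φ
ι (φ ∧₀ ψ) = ι φ ∧ ι ψ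

_⇒_ : {P : Set} → L≤ P → L≤ P → L≤ P
φ ⇒ ψ = ∼ (φ ∧ ∼ ψ)

_,_⊨₀_ : {P : Set} (M : PrefModel P) → W M → L₀ P → Set
M , w ⊨₀ atom p = v M p w
M , w ⊨₀ (¬₀ φ) = ¬ (M , w ⊨₀ φ)
M , w ⊨₀ (φ ∧₀ ψ) = (M , w ⊨₀ φ) × (M , w ⊨₀ ψ)

Sat : {P : Set} (⋆ : DynOp P) (M : PrefModel P) → W M → L≤ P → Set
Sat ⋆ M w (atom p) = v M p w
Sat ⋆ M w (∼ ξ) = ¬ Sat ⋆ M w ξ
Sat ⋆ M w (ξ ∧ χ) = Sat ⋆ M w ξ × Sat ⋆ M w χ
Sat ⋆ M w (A ξ) = ∀ u → Sat ⋆ M u ξ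
Sat ⋆ M w ([≤] ξ) = ∀ u → _≤_ M u w → Sat ⋆ M u ξ
Sat ⋆ M w ([<] ξ) = ∀ u → _<_ M u w → Sat ⋆ M u ξ
Sat ⋆ M w ([⋆ φ ] ξ) = Sat ⋆ (upd ⋆ M φ) w ξ

ModelClass : Set → Set₂
ModelClass P = PrefModel P → Set₁

ClosedUnder : {P : Set} → ModelClass P → DynOp P → Set₁
ClosedUnder 𝔐 ⋆ = ∀ M → 𝔐 M → ∀ φ → 𝔐 (upd ⋆ M φ)

Valid : {P : Set} → ModelClass P → DynOp P → L≤ P → Set₁
Valid 𝔐 ⋆ ξ = ∀ M → 𝔐 M → ∀ w → Sat ⋆ M w ξ

CR4Compliant : {P : Set} → ModelClass P → DynOp P → Set₁
CR4Compliant 𝔐 ⋆ =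
  ∀ M → 𝔐 M → ∀ φ (w w' : W M) →
  ¬ (M , w ⊨₀ φ) → (M , w' ⊨₀ φ) → _≤_ M w w' →
  ∀ ξ → Sat ⋆ M w ([⋆ φ ] ξ) →
  Σ (W M) λ w'' → ¬ (M , w'' ⊨₀ φ) × Sat ⋆ M w'' ([⋆ φ ] ξ)
                  × PrefOrder._≤_ (⋆ M φ) w'' w'

CR4Axiom : {P : Set} → L₀ P → L≤ P → L≤ P
CR4Axiom φ ξ = ([⋆ φ ] [≤] ((∼ ι φ) ⇒ ξ)) ⇒ (ι φ ⇒ [≤] ([⋆ φ ] ((∼ ι φ) ⇒ ξ)))

ExcludedMiddle : Set₁
ExcludedMiddle = (X : Set) → X ⊎ ¬ X

-- The axiom for a formula ¬ξ at a world w' is exactly the contrapositive of CR4a for ξ at w':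
-- CR4a produces, from a ¬φ-world below w' satisfying [⋆φ]ξ, a ¬φ-world ⋆φ-below w' satisfying
-- [⋆φ]ξ, which the premise [⋆φ][≤](¬φ → ¬ξ) of the axiom forbids. Classical logic enters twice:
-- to pass between ξ and ¬¬ξ, and to produce the CR4a witness from the impossibility of its absence.
module Submission where

open import Defs
open import Data.Empty using (⊥-elim)
open import Data.Product using (∃; _×_; _,_)
open import Data.Sum using (inj₁; inj₂)
open import Function.Base using (id)
open import Function.Bundles using (_⇔_; mk⇔; module Equivalence)
open import Level using (0ℓ)
open import Relation.Binary.Core using (Rel)
open import Relation.Binary.PropositionalEquality using (_≡_; refl; cong; cong₂; trans; sym; subst)
open import Relation.Nullary using (¬_)
open import Relation.Nullary.Negation using (Stable)
open import Relation.Unary using (Pred)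

open PrefModel using (W; _≤_)

¬¬-elim : ExcludedMiddle → {X : Set} → Stable X
¬¬-elim em {X} ¬¬x with em X
... | inj₁ x  = x
... | inj₂ ¬x = ⊥-elim (¬¬x ¬x)

module _ {W : Set} (_≤⋆_ _≤₀_ : Rel W 0ℓ) (φ : Pred W 0ℓ) where

  AxiomAt : Pred W 0ℓ → Pred W 0ℓ
  AxiomAt Q w = (∀ u → u ≤⋆ w → ¬ φ u → Q u) → φ w → ∀ u → u ≤₀ w → ¬ φ u → Q u

  CR4At : Pred W 0ℓ → Pred W 0ℓ
  CR4At Q w' = φ w' → ∀ w → w ≤₀ w' → ¬ φ w → Q w → ∃ λ w'' → ¬ φ w'' × Q w'' × w'' ≤⋆ w'

  cr4⇒axiom : ExcludedMiddle → ∀ {Q w} → CR4At (λ u → ¬ Q u) w → AxiomAt Q w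
  cr4⇒axiom em cr premise φw u u≤w ¬φu = ¬¬-elim em λ ¬Qu →
    let (w'' , ¬φw'' , ¬Qw'' , w''≤⋆w) = cr φw u u≤w ¬φu ¬Qu
    in ¬Qw'' (premise w'' w''≤⋆w ¬φw'')

  axiom⇒cr4 : ExcludedMiddle → ∀ {Q w'} → AxiomAt (λ u → ¬ Q u) w' → CR4At Q w'
  axiom⇒cr4 em {Q} {w'} ax φw' w w≤w' ¬φw Qw with em (∃ λ w'' → ¬ φ w'' × Q w'' × w'' ≤⋆ w')
  ... | inj₁ witness   = witness
  ... | inj₂ ¬witness = ⊥-elim (ax premise φw' w w≤w' ¬φw Qw)
    where
    premise : ∀ u → u ≤⋆ w' → ¬ φ u → ¬ Q u
    premise u u≤⋆w' ¬φu Qu = ¬witness (u , ¬φu , Qu , u≤⋆w')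

module _ {P : Set} (⋆ : DynOp P) where

  Sat-ι : ∀ N u ψ → Sat ⋆ N u (ι ψ) ≡ (N , u ⊨₀ ψ)
  Sat-ι N u (atom p) = refl
  Sat-ι N u (¬₀ ψ)   = cong ¬_ (Sat-ι N u ψ)
  Sat-ι N u (ψ ∧₀ χ) = cong₂ _×_ (Sat-ι N u ψ) (Sat-ι N u χ)

  ⊨₀-upd : ∀ M φ u ψ → (upd ⋆ M φ , u ⊨₀ ψ) ≡ (M , u ⊨₀ ψ)
  ⊨₀-upd M φ u (atom p) = refl
  ⊨₀-upd M φ u (¬₀ ψ)   = cong ¬_ (⊨₀-upd M φ u ψ)
  ⊨₀-upd M φ u (ψ ∧₀ χ) = cong₂ _×_ (⊨₀-upd M φ u ψ) (⊨₀-upd M φ u χ)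

  Sat-ι-upd : ∀ M φ u ψ → Sat ⋆ (upd ⋆ M φ) u (ι ψ) ≡ (M , u ⊨₀ ψ)
  Sat-ι-upd M φ u ψ = trans (Sat-ι (upd ⋆ M φ) u ψ) (⊨₀-upd M φ u ψ)

  Sat-CR4Axiom : ExcludedMiddle → ∀ M φ ξ w →
    Sat ⋆ M w (CR4Axiom φ ξ) ⇔
    AxiomAt (_≤_ (upd ⋆ M φ)) (_≤_ M) (λ u → M , u ⊨₀ φ) (λ u → Sat ⋆ (upd ⋆ M φ) u ξ) w
  Sat-CR4Axiom em M φ ξ w = mk⇔ to from
    where
    φ↑ : M , w ⊨₀ φ → Sat ⋆ M w (ι φ)
    φ↑ = subst id (sym (Sat-ι M w φ))

    φ↓ : Sat ⋆ M w (ι φ) → M , w ⊨₀ φ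
    φ↓ = subst id (Sat-ι M w φ)

    ¬φ↑ : ∀ u → ¬ (M , u ⊨₀ φ) → ¬ Sat ⋆ (upd ⋆ M φ) u (ι φ)
    ¬φ↑ u = subst ¬_ (sym (Sat-ι-upd M φ u φ))

    ¬φ↓ : ∀ u → ¬ Sat ⋆ (upd ⋆ M φ) u (ι φ) → ¬ (M , u ⊨₀ φ)
    ¬φ↓ u = subst ¬_ (Sat-ι-upd M φ u φ)

    to : Sat ⋆ M w (CR4Axiom φ ξ) →
         AxiomAt (_≤_ (upd ⋆ M φ)) (_≤_ M) (λ u → M , u ⊨₀ φ) (λ u → Sat ⋆ (upd ⋆ M φ) u ξ) w
    to sat premise φw u u≤w ¬φu = ¬¬-elim em λ ¬ξu →
      sat ( (λ u' u'≤⋆w (¬φu' , ¬ξu') → ¬ξu' (premise u' u'≤⋆w (¬φ↓ u' ¬φu')))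
          , λ concl → concl (φ↑ φw , λ below → below u u≤w (¬φ↑ u ¬φu , ¬ξu)))

    from : AxiomAt (_≤_ (upd ⋆ M φ)) (_≤_ M) (λ u → M , u ⊨₀ φ) (λ u → Sat ⋆ (upd ⋆ M φ) u ξ) w →
           Sat ⋆ M w (CR4Axiom φ ξ)
    from ax (premise , ¬concl) = ¬concl λ (φw , ¬below) → ¬below λ u u≤w (¬φu , ¬ξu) →
      ¬ξu (ax premise′ (φ↓ φw) u u≤w (¬φ↓ u ¬φu))
      where
      premise′ : ∀ u → _≤_ (upd ⋆ M φ) u w → ¬ (M , u ⊨₀ φ) → Sat ⋆ (upd ⋆ M φ) u ξ
      premise′ u u≤⋆w ¬φu = ¬¬-elim em λ ¬ξu → premise u u≤⋆w (¬φ↑ u ¬φu , ¬ξu)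

proposition45 : ExcludedMiddle → {P : Set} (𝔐 : ModelClass P) (⋆ : DynOp P) →
    ClosedUnder 𝔐 ⋆ →
    ((∀ φ ξ → Valid 𝔐 ⋆ (CR4Axiom φ ξ)) ⇔ CR4Compliant 𝔐 ⋆)
proposition45 em 𝔐 ⋆ _ = mk⇔ axiom⇒compliant compliant⇒axiom
  where
  open Equivalence

  axiom⇒compliant : (∀ φ ξ → Valid 𝔐 ⋆ (CR4Axiom φ ξ)) → CR4Compliant 𝔐 ⋆
  axiom⇒compliant valid M m φ w w' ¬φw φw' w≤w' ξ =
    axiom⇒cr4 (_≤_ (upd ⋆ M φ)) (_≤_ M) _ em
      (to (Sat-CR4Axiom ⋆ em M φ (∼ ξ) w') (valid φ (∼ ξ) M m w'))
      φw' w w≤w' ¬φw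

  compliant⇒axiom : CR4Compliant 𝔐 ⋆ → ∀ φ ξ → Valid 𝔐 ⋆ (CR4Axiom φ ξ)
  compliant⇒axiom compliant φ ξ M m w' =
    from (Sat-CR4Axiom ⋆ em M φ ξ w')
      (cr4⇒axiom (_≤_ (upd ⋆ M φ)) (_≤_ M) _ em
        λ φw' w w≤w' ¬φw → compliant M m φ w w' ¬φw φw' w≤w' (∼ ξ))
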